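{- In the silent-robot model described below, dispersion cannot be achieved by a set of mobile robots if the memory available to each robot is $o(\log L)$, where robot ids lie in $[0,L]$. That is, there is no deterministic algorithm which, for every $L$, solves dispersion (with termination) on every connected anonymous port-labeled graph for every set of co-located robots with distinct ids in $[0,L]$, while each robot uses only $o(\log L)$ bits of memory.
   Context: Model. The graph $G=(V,E)$ is connected, its nodes are anonymous, and the edges incident to a node of degree $d$ carry distinct local port numbers $0,\dots,d-1$. Robots start co-located at a single node $s$, have distinct integer ids in $[0,L]$, each knowing only its own id (not the other ids, the number $k$ of robots, or $L$). Robots act in synchronous rounds: local computation, then either stay or traverse one incident edge; on entering a node a robot learns the incoming port and the node's degree. Robots cannot communicate at all. The only information a robot at node $v$ receives at the beginning of a round is whether it is alone at $v$, and (if it stayed at $v$ in the previous round) whether the number of robots at $v$ increased or decreased compared to the previous round. A robot's behavior in each round is determined by its memory state (its memory contents, which initially depend only on its id) and these observed events. Dispersion: the robots must end at pairwise distinct nodes and terminate in finitely many rounds. -}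

module Defs where

open import Data.Nat using (ℕ; zero; suc; _+_; _*_; _^_; _≤_; _<ᵇ_)
open import Data.Nat.Logarithm using (⌊log₂_⌋)
open import Data.Fin using (Fin; toℕ; _≟_)
import Data.Fin as F
open import Data.Bool using (Bool; true; false; if_then_else_)
open import Data.Product using (Σ; ∃; ∃-syntax; _×_; _,_; proj₁; proj₂)
open import Relation.Nullary using (¬_; yes; no)
open import Relation.Binary.PropositionalEquality using (_≡_; _≢_)
open import Function.Definitions using (Injective)

record PortGraph : Set where
  field
    n    : ℕ                                   -- number of nodes (nodes are anonymous)
    deg  : Fin n → ℕ
    nbr  : (v : Fin n) → Fin (deg v) → Fin n
    back : (v : Fin n) (p : Fin (deg v)) → Fin (deg (nbr v p))  -- port at the other end
    back-nbr  : ∀ v p → nbr (nbr v p) (back v p) ≡ v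
    back-back : ∀ v p → toℕ (back (nbr v p) (back v p)) ≡ toℕ p
    no-loop   : ∀ v p → nbr v p ≢ v
    no-multi  : ∀ v p q → nbr v p ≡ nbr v q → p ≡ q

open PortGraph public

data Walk (G : PortGraph) : Fin (n G) → Fin (n G) → Set where
  here : ∀ {v} → Walk G v v
  step : ∀ {u w} (p : Fin (deg G u)) → Walk G (nbr G u p) w → Walk G u w

Connected : PortGraph → Set
Connected G = ∀ u v → Walk G u v

-- change of the number of robots at the node, compared to the previous round
data Delta : Set where
  increased decreased unchanged : Delta

data Event : Set where
  evStart   : Event                 -- first round, at the start node
  evStayed  : Delta → Event         -- stayed in the previous round
  evEntered : ℕ → Event             -- entered the node through the given port

record Obs : Set where
  constructor obs
  field
    degree : ℕ
    alone  : Bool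
    event  : Event

data Action (d : ℕ) : Set where
  stay : Action d
  halt : Action d                   -- terminate (stay forever afterwards)
  move : Fin d → Action d

-- A deterministic algorithm for robots whose ids lie in [0,L],
-- with S possible memory states.
record Algorithm (L S : ℕ) : Set where
  field
    init  : Fin (suc L) → Fin S
    trans : Fin S → (o : Obs) → Fin S × Action (Obs.degree o)

data Arrival : Set where
  aStart aStay : Arrival
  aEnter : ℕ → Arrival

count : ∀ {m} k → (Fin k → Fin m) → Fin m → ℕ
count zero    f v = 0
count (suc k) f v with f F.zero ≟ v
... | yes _ = suc (count k (λ i → f (F.suc i)) v)
... | no  _ = count k (λ i → f (F.suc i)) v

record Config (G : PortGraph) (k S : ℕ) : Set where
  field
    pos    : Fin k → Fin (n G)
    prev   : Fin k → Fin (n G)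
    mem    : Fin k → Fin S
    halted : Fin k → Bool
    arr    : Fin k → Arrival       -- how the robot got to its current node
open Config public

compareCounts : ℕ → ℕ → Delta
compareCounts before now =
  if before <ᵇ now then increased else (if now <ᵇ before then decreased else unchanged)

module _ {L S : ℕ} (A : Algorithm L S) (G : PortGraph) {k : ℕ} where
  open Algorithm A

  observe : Config G k S → Fin k → Obs
  observe c i = obs (deg G v) al ev
    where
      v  = pos c i
      al = if count k (pos c) v Data.Nat.≡ᵇ 1 then true else false
      ev : Event
      ev with arr c i
      ... | aStart   = evStart
      ... | aStay    = evStayed (compareCounts (count k (prev c) v) (count k (pos c) v))
      ... | aEnter q = evEntered q

  robotStep : Config G k S → Fin k → Fin (n G) × Fin S × Bool × Arrival
  robotStep c i with halted c i
  ... | true  = pos c i , mem c i , true , aStay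
  ... | false with trans (mem c i) (observe c i)
  ...   | m' , stay   = pos c i , m' , false , aStay
  ...   | m' , halt   = pos c i , m' , true  , aStay
  ...   | m' , move p = nbr G (pos c i) p , m' , false ,
                        aEnter (toℕ (back G (pos c i) p))

  nextConfig : Config G k S → Config G k S
  nextConfig c = record
    { pos    = λ i → proj₁ (robotStep c i)
    ; prev   = pos c
    ; mem    = λ i → proj₁ (proj₂ (robotStep c i))
    ; halted = λ i → proj₁ (proj₂ (proj₂ (robotStep c i)))
    ; arr    = λ i → proj₂ (proj₂ (proj₂ (robotStep c i)))
    }

  initConfig : Fin (n G) → (Fin k → Fin (suc L)) → Config G k S
  initConfig s ids = record
    { pos = λ _ → s ; prev = λ _ → s ; mem = λ i → init (ids i)
    ; halted = λ _ → false ; arr = λ _ → aStart }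

  run : Fin (n G) → (Fin k → Fin (suc L)) → ℕ → Config G k S
  run s ids zero    = initConfig s ids
  run s ids (suc t) = nextConfig (run s ids t)

Dispersed : ∀ {G k S} → Config G k S → Set
Dispersed {k = k} c = (∀ (i : Fin k) → halted c i ≡ true) × Injective _≡_ _≡_ (pos c)

SolvesDispersion : ∀ {L S} → Algorithm L S → Set
SolvesDispersion {L} {S} A =
  ∀ (G : PortGraph) → Connected G → (s : Fin (n G)) →
  ∀ (k : ℕ) → k ≤ n G → (ids : Fin k → Fin (suc L)) → Injective _≡_ _≡_ ids →
  ∃[ T ] Dispersed (run A G s ids T)

-- f(L) = o(log L):  for every c, eventually c · f(L) ≤ log₂ L
LittleOLog : (ℕ → ℕ) → Set
LittleOLog f = ∀ (c : ℕ) → ∃[ L₀ ] ∀ L → L₀ ≤ L → c * f L ≤ ⌊log₂ L ⌋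

-- Two robots whose ids are mapped to the same initial memory state receive
-- identical observations in every round when started together, so they
-- move in lockstep and can never end at distinct nodes. Hence an algorithm
-- solving dispersion must have an injective initial map from the L + 1 ids
-- into its memory states, i.e. at least log₂(L + 1) bits of memory, which
-- o(log L) bits do not provide once L is large.
module Submission where

open import Defs
open import Data.Nat using (ℕ; zero; suc; _^_; _*_; _≤_; _≤?_; z≤n; s≤s; z<s)
open import Data.Nat.Properties using (≤-refl; ≤-trans; <⇒≤; <⇒≱; ≰⇒>; m<m+n; m≤n+m; n≮n)
open import Data.Nat.Logarithm using (⌊log₂_⌋; ⌊log₂⌋-mono-≤; ⌊log₂[2^n]⌋≡n)
open import Data.Fin using (Fin; toℕ; _≟_)
import Data.Fin as F
open import Data.Fin.Properties using (injective⇒≤)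
open import Data.Bool using (Bool; true; false)
open import Data.Product using (Σ; _×_; _,_; proj₁; proj₂)
open import Data.Empty using (⊥-elim)
open import Function.Definitions using (Injective)
open import Relation.Nullary using (¬_; yes; no)
open import Relation.Binary.PropositionalEquality
  using (_≡_; _≢_; refl; sym; cong; cong₂; subst; module ≡-Reasoning)

K₂ : PortGraph
K₂ = record
  { n = 2 ; deg = λ _ → 1 ; nbr = other ; back = λ _ _ → F.zero
  ; back-nbr = other-involutive ; back-back = λ { _ F.zero → refl }
  ; no-loop = other-≢ ; no-multi = λ { _ F.zero F.zero _ → refl } }
  where
    other : Fin 2 → Fin 1 → Fin 2
    other F.zero         _ = F.suc F.zero
    other (F.suc F.zero) _ = F.zero

    other-involutive : ∀ v p → other (other v p) F.zero ≡ v
    other-involutive F.zero         _ = refl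
    other-involutive (F.suc F.zero) _ = refl

    other-≢ : ∀ v p → other v p ≢ v
    other-≢ F.zero         _ ()
    other-≢ (F.suc F.zero) _ ()

K₂-connected : Connected K₂
K₂-connected F.zero         F.zero         = here
K₂-connected F.zero         (F.suc F.zero) = step F.zero here
K₂-connected (F.suc F.zero) F.zero         = step F.zero here
K₂-connected (F.suc F.zero) (F.suc F.zero) = here

pair : ∀ {a} {A : Set a} → A → A → Fin 2 → A
pair x y F.zero         = x
pair x y (F.suc F.zero) = y

pair-injective : ∀ {a} {A : Set a} {x y : A} → x ≢ y → Injective _≡_ _≡_ (pair x y)
pair-injective x≢y {F.zero}       {F.zero}       _  = refl
pair-injective x≢y {F.zero}       {F.suc F.zero} eq = ⊥-elim (x≢y eq)
pair-injective x≢y {F.suc F.zero} {F.zero}       eq = ⊥-elim (x≢y (sym eq))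
pair-injective x≢y {F.suc F.zero} {F.suc F.zero} _  = refl

module Lockstep {L S : ℕ} (A : Algorithm L S) (G : PortGraph) {k : ℕ} where
  open Algorithm A using (init) renaming (trans to transition)
  open ≡-Reasoning

  State : Set
  State = Fin (n G) × Fin S × Bool × Arrival

  state : Config G k S → Fin k → State
  state c i = pos c i , mem c i , halted c i , arr c i

  resume : State → Obs → State
  resume (v , m , true  , _) _ = v , m , true , aStay
  resume (v , m , false , _) o with transition m (obs (deg G v) (Obs.alone o) (Obs.event o))
  ... | m′ , stay   = v , m′ , false , aStay
  ... | m′ , halt   = v , m′ , true , aStay
  ... | m′ , move p = nbr G v p , m′ , false , aEnter (toℕ (back G v p))

  robotStep≡resume : ∀ c i → robotStep A G c i ≡ resume (state c i) (observe A G c i)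
  robotStep≡resume c i with halted c i
  ... | true  = refl
  ... | false with transition (mem c i) (observe A G c i)
  ...   | _ , stay   = refl
  ...   | _ , halt   = refl
  ...   | _ , move _ = refl

  observe-cong : ∀ (c : Config G k S) {i j} → pos c i ≡ pos c j → arr c i ≡ arr c j →
                 observe A G c i ≡ observe A G c j
  observe-cong c {i} {j} pos≡ arr≡ with arr c i | arr c j | arr≡
  ... | aStart   | _ | refl rewrite pos≡ = refl
  ... | aStay    | _ | refl rewrite pos≡ = refl
  ... | aEnter _ | _ | refl rewrite pos≡ = refl

  robotStep-cong : ∀ c {i j} → state c i ≡ state c j → robotStep A G c i ≡ robotStep A G c j
  robotStep-cong c {i} {j} eq = begin
    robotStep A G c i                       ≡⟨ robotStep≡resume c i ⟩
    resume (state c i) (observe A G c i)    ≡⟨ cong₂ resume eq (observe-cong c pos≡ arr≡) ⟩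
    resume (state c j) (observe A G c j)    ≡⟨ robotStep≡resume c j ⟨
    robotStep A G c j                       ∎
    where
      pos≡ : pos c i ≡ pos c j
      pos≡ = cong proj₁ eq
      arr≡ : arr c i ≡ arr c j
      arr≡ = cong (λ σ → proj₂ (proj₂ (proj₂ σ))) eq

  run-lockstep : ∀ s ids {i j} → init (ids i) ≡ init (ids j) →
                 ∀ t → state (run A G s ids t) i ≡ state (run A G s ids t) j
  run-lockstep s ids init≡ zero    = cong (λ m → s , m , false , aStart) init≡
  run-lockstep s ids init≡ (suc t) = robotStep-cong (run A G s ids t) (run-lockstep s ids init≡ t)

init-injective : ∀ {L S} (A : Algorithm L S) → SolvesDispersion A →
                 Injective _≡_ _≡_ (Algorithm.init A)
init-injective A solves {i} {j} init≡ with i ≟ j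
... | yes i≡j = i≡j
... | no  i≢j with solves K₂ K₂-connected F.zero 2 ≤-refl (pair i j) (pair-injective i≢j)
...   | T , _ , pos-injective
  with pos-injective (cong proj₁ (Lockstep.run-lockstep A K₂ F.zero (pair i j) init≡ T))
...   | ()

2*b≤⌊log₂n⌋⇒2^b≤n : ∀ {n} b → 1 ≤ n → 2 * b ≤ ⌊log₂ n ⌋ → 2 ^ b ≤ n
2*b≤⌊log₂n⌋⇒2^b≤n zero 1≤n _ = 1≤n
2*b≤⌊log₂n⌋⇒2^b≤n {n} (suc b) _ 2b≤log with 2 ^ suc b ≤? n
... | yes 2^b≤n = 2^b≤n
... | no  2^b≰n = ⊥-elim (<⇒≱ (m<m+n (suc b) z<s) (≤-trans 2b≤log log≤b))
  where
    log≤b : ⌊log₂ n ⌋ ≤ suc b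
    log≤b = subst (⌊log₂ n ⌋ ≤_) (⌊log₂[2^n]⌋≡n (suc b)) (⌊log₂⌋-mono-≤ (<⇒≤ (≰⇒> 2^b≰n)))

theorem3 : ¬ (Σ (ℕ → ℕ) λ bits → LittleOLog bits ×
               Σ ((L : ℕ) → Algorithm L (2 ^ bits L)) λ A → ∀ L → SolvesDispersion (A L))
theorem3 (bits , o-log , A , solves) with o-log 2
... | L₀ , eventually = n≮n L (≤-trans ids≤states states≤L)
  where
    L : ℕ
    L = suc L₀
    ids≤states : suc L ≤ 2 ^ bits L
    ids≤states = injective⇒≤ (init-injective (A L) (solves L))
    states≤L : 2 ^ bits L ≤ L
    states≤L = 2*b≤⌊log₂n⌋⇒2^b≤n (bits L) (s≤s z≤n) (eventually L (m≤n+m L₀ 1))
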